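{- For every graph $G$ and $r\in\mathbb N$, $\mathrm{pmw}_r(G)\le 2\cdot\mathrm{dmw}_r(G)+1$.
   Context: Graphs are finite, simple, undirected. For a partition $\mathcal P$ of $V(G)$ and $X\subseteq V(G)$, $X/\mathcal P$ is the set of parts intersecting $X$. A $\mathcal P$-flip of $G$ is obtained by choosing pairs $(X,Y)$ of parts (possibly $X=Y$) and complementing the adjacency between all pairs of distinct vertices $x\in X,y\in Y$. $\mathrm{dist}_{\mathcal P}(x,y)=\max\mathrm{dist}_{G'}(x,y)$ over $\mathcal P$-flips $G'$; $\mathrm{Ball}^r_{\mathcal P}(v)=\{x:\mathrm{dist}_{\mathcal P}(x,v)\le r\}$. For $S\subseteq V(G)$, $\mathcal N_S$ is the partition in which each vertex of $S$ is a singleton and $u,v\notin S$ are in the same part iff $N(u)\cap S=N(v)\cap S$. $\mathrm{pmw}_r(G)$ is the minimum over sequences $\mathcal P_1\preceq\dots\preceq\mathcal P_m$ of partitions of $V(G)$ (each coarser than or equal to the previous) with $\mathcal P_1$ into singletons and $\mathcal P_m=\{V(G)\}$ of $\max_{1\le i<m}\max_v|\mathrm{Ball}^r_{\mathcal P_{i+1}}(v)/\mathcal P_i|$. $\mathrm{dmw}_r(G)$ is the minimum over total orders $v_1<\dots<v_n$ of $V(G)$ of $\max_{1\le i\le n}\max_v|\mathrm{Ball}^r_{\mathcal P_i}(v)/\mathcal P_i|$, where $\mathcal P_i=\mathcal N_{\{v_1,\dots,v_{n-i}\}}$. -}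

module Defs where

open import Data.Nat using (ℕ; zero; suc; _≤_; _<_; _∸_; _+_; _*_)
open import Data.Fin using (Fin; toℕ; inject₁; fromℕ)
open import Data.Bool using (Bool; true; false; _xor_)
open import Data.Product using (Σ; ∃; _×_; _,_)
open import Data.Sum using (_⊎_)
open import Relation.Nullary using (¬_)
open import Relation.Binary.PropositionalEquality using (_≡_; _≢_)
open import Relation.Binary.Structures using (IsEquivalence)
open import Function.Definitions using (Injective)

record Graph (n : ℕ) : Set where
  field
    adj    : Fin n → Fin n → Bool
    sym    : ∀ u v → adj u v ≡ adj v u
    irrefl : ∀ v → adj v v ≡ false
open Graph public

-- A binary relation on the vertices; partitions are represented by their
-- "same part" relation (required to be an equivalence where the paper
-- speaks of partitions).
VRel : ℕ → Set₁
VRel n = Fin n → Fin n → Set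

-- A flip specification for partition P: a symmetric Boolean choice on pairs of
-- vertices that is constant on pairs of parts (= a set of unordered pairs of
-- parts {X,Y}, X = Y allowed).
record Flip {n : ℕ} (P : VRel n) : Set where
  field
    F     : Fin n → Fin n → Bool
    F-sym : ∀ u v → F u v ≡ F v u
    F-resp : ∀ u u' v v' → P u u' → P v v' → F u v ≡ F u' v'
open Flip public

FlipEdge : ∀ {n} (G : Graph n) {P : VRel n} → Flip P → Fin n → Fin n → Set
FlipEdge G f x y = x ≢ y × (adj G x y xor F f x y) ≡ true

data WithinDist {n : ℕ} (E : Fin n → Fin n → Set) : ℕ → Fin n → Fin n → Set where
  here : ∀ {k x} → WithinDist E k x x
  step : ∀ {k x y z} → E x z → WithinDist E k z y → WithinDist E (suc k) x y

-- x ∈ Ball^r_P(v)  iff  dist_P(x,v) ≤ r, i.e. dist_{G'}(x,v) ≤ r for every P-flip G'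
InBall : ∀ {n} (G : Graph n) (P : VRel n) (r : ℕ) (v x : Fin n) → Set
InBall G P r v x = (f : Flip P) → WithinDist (FlipEdge G f) r x v

-- |X / P| ≤ k : at most k parts of P intersect X
-- (there are k vertices such that every element of X shares a part with one of them)
PartsAtMost : ∀ {n} (P : VRel n) (X : Fin n → Set) (k : ℕ) → Set
PartsAtMost {n} P X k = Σ (Fin k → Fin n) λ w → ∀ x → X x → ∃ λ i → P x (w i)

_⪯_ : ∀ {n} → VRel n → VRel n → Set
P ⪯ Q = ∀ u v → P u v → Q u v

Discrete : ∀ {n} → VRel n → Set
Discrete P = ∀ u v → P u v → u ≡ v

Trivial : ∀ {n} → VRel n → Set
Trivial P = ∀ u v → P u v

-- pmw_r(G) ≤ k : there is a sequence P_1 ⪯ … ⪯ P_m (m = suc m') of partitions,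
-- P_1 singletons, P_m = {V(G)}, with max_{i<m} max_v |Ball^r_{P_{i+1}}(v)/P_i| ≤ k.
PmwAtMost : ∀ {n} (G : Graph n) (r k : ℕ) → Set₁
PmwAtMost {n} G r k =
  Σ ℕ λ m' → Σ (Fin (suc m') → VRel n) λ Ps →
    (∀ i → IsEquivalence (Ps i)) ×
    Discrete (Ps Data.Fin.zero) ×
    Trivial (Ps (fromℕ m')) ×
    (∀ (i : Fin m') → Ps (inject₁ i) ⪯ Ps (Data.Fin.suc i)) ×
    (∀ (i : Fin m') (v : Fin n) →
       PartsAtMost (Ps (inject₁ i)) (InBall G (Ps (Data.Fin.suc i)) r v) k)

NPart : ∀ {n} (G : Graph n) (S : Fin n → Set) → VRel n
NPart G S u v = u ≡ v ⊎ (¬ S u × ¬ S v × (∀ s → S s → adj G u s ≡ adj G v s))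

-- the first t vertices of the order σ (v_j = σ j, 0-indexed)
Prefix : ∀ {n} (σ : Fin n → Fin n) (t : ℕ) → Fin n → Set
Prefix σ t x = ∃ λ j → σ j ≡ x × toℕ j < t

-- dmw_r(G) ≤ k : there is a total order v_1 < … < v_n (a bijection σ : Fin n → Fin n,
-- v_{j+1} = σ j) such that for all 1 ≤ i ≤ n and all v,
-- |Ball^r_{P_i}(v)/P_i| ≤ k where P_i = N_{{v_1,…,v_{n-i}}}.
DmwAtMost : ∀ {n} (G : Graph n) (r k : ℕ) → Set
DmwAtMost {n} G r k =
  Σ (Fin n → Fin n) λ σ → Injective _≡_ _≡_ σ ×
    (∀ (i : ℕ) → 1 ≤ i → i ≤ n → ∀ (v : Fin n) →
       PartsAtMost (NPart G (Prefix σ (n ∸ i)))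
                   (InBall G (NPart G (Prefix σ (n ∸ i))) r v) k)

-- Take the partitions of the pmw-sequence to be the neighbourhood partitions
-- N_{v_1…v_{n-i}} of the dmw-order, for i = 0, …, n. Passing from
-- S' = {v_1,…,v_{n-i-1}} to S = S' ∪ {s} with s = v_{n-i} refines each part of
-- N_{S'} into at most two parts of N_S (by adjacency to s) plus the singleton
-- {s}; hence a ball meeting at most k parts of N_{S'} meets at most 2k+1 parts
-- of N_S.
module Submission where

open import Defs hiding (sym)
open import Data.Nat using (ℕ; suc; _+_; _*_; _∸_; _≤_; _<?_; z≤n; s≤s)
import Data.Nat as ℕ
open import Data.Nat.Properties
  using (1+n≰n; ≤∧≢⇒<; n≤1+n; n∸n≡0; +-∸-assoc; +-identityʳ; ≤-reflexive; ≤-trans; <-≤-trans)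
open import Data.Fin using (Fin; zero; toℕ; inject₁; fromℕ; punchOut; _↑ˡ_; _↑ʳ_; _≟_)
open import Data.Fin.Properties
  using (any?; all?; toℕ<n; toℕ-inject₁; toℕ-fromℕ; toℕ-injective; opposite-prop;
         punchOut-injective; injective⇒≤)
open import Data.Vec.Functional using (_++_)
open import Data.Vec.Functional.Properties using (lookup-++ˡ; lookup-++ʳ)
open import Data.Bool using (Bool; true; false)
import Data.Bool.Properties as Bool
open import Data.Product using (Σ; ∃; _×_; _,_; proj₁; proj₂)
open import Data.Sum using (inj₁; inj₂)
open import Relation.Nullary using (¬_; Dec; yes; no; contradiction)
open import Relation.Nullary.Decidable using (_×-dec_; _⊎-dec_; _→-dec_; ¬?)
open import Level using (0ℓ)
open import Relation.Unary using (Pred; Decidable; _⊆_; _∪_; _∩_; ｛_｝)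
open import Relation.Binary.PropositionalEquality
  using (_≡_; _≢_; refl; sym; trans; cong; subst)
open import Relation.Binary.Structures using (IsEquivalence; IsPartialEquivalence)
open import Function.Base using (_∘′_)
open import Function.Definitions using (Injective)

private
  variable
    n k : ℕ

injective⇒surjective : {σ : Fin n → Fin n} → Injective _≡_ _≡_ σ → ∀ x → ∃ λ j → σ j ≡ x
injective⇒surjective {suc n} {σ} σ-inj x with any? (λ j → σ j ≟ x)
... | yes hit = hit
... | no miss = contradiction (injective⇒≤ avoid-injective) 1+n≰n
  where
  avoid : Fin (suc n) → Fin n
  avoid j = punchOut {i = x} {j = σ j} (λ x≡σj → miss (j , sym x≡σj))

  avoid-injective : Injective _≡_ _≡_ avoid
  avoid-injective eq = σ-inj (punchOut-injective {i = x} _ _ eq)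

module _ {P : VRel n} where

  partsAtMost-⊆ : {X Y : Pred (Fin n) 0ℓ} → X ⊆ Y → PartsAtMost P Y k → PartsAtMost P X k
  partsAtMost-⊆ X⊆Y (w , cover) = w , λ x x∈X → cover x (X⊆Y x∈X)

  partsAtMost-∪ : ∀ {a b} {X Y : Pred (Fin n) 0ℓ} →
                  PartsAtMost P X a → PartsAtMost P Y b → PartsAtMost P (X ∪ Y) (a + b)
  partsAtMost-∪ {a} {b} {X} {Y} (w , coverX) (w′ , coverY) = w ++ w′ , cover
    where
    cover : ∀ x → (X ∪ Y) x → ∃ λ i → P x ((w ++ w′) i)
    cover x (inj₁ x∈X) with i , p ← coverX x x∈X =
      i ↑ˡ b , subst (P x) (sym (lookup-++ˡ w w′ i)) p
    cover x (inj₂ x∈Y) with i , p ← coverY x x∈Y =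
      a ↑ʳ i , subst (P x) (sym (lookup-++ʳ w w′ i)) p

  partsAtMost-｛｝ : (∀ x → P x x) → ∀ s → PartsAtMost P ｛ s ｝ 1
  partsAtMost-｛｝ P-refl s = (λ _ → s) , λ { x refl → zero , P-refl x }

  -- In each Q-part of the cover, choose a representative in Y if there is one.
  partsAtMost-refine : ∀ {Q : VRel n} {X Y : Pred (Fin n) 0ℓ} →
                       (∀ u v → Dec (Q u v)) → IsPartialEquivalence Q → Decidable Y →
                       (∀ {x y} → Y x → Y y → Q x y → P x y) →
                       PartsAtMost Q X k → PartsAtMost P (X ∩ Y) k
  partsAtMost-refine {k = k} {Q = Q} {X} {Y} Q? Q-per Y? Q∩Y⇒P (w , cover) =
    (λ i → proj₁ (representative i)) , refined
    where
    open IsPartialEquivalence Q-per renaming (sym to Q-sym; trans to Q-trans)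

    InPart : Fin k → Pred (Fin n) 0ℓ
    InPart i u = Y u × Q u (w i)

    representative : ∀ i → Σ (Fin n) λ u → ∃ (InPart i) → InPart i u
    representative i with any? (λ u → Y? u ×-dec Q? u (w i))
    ... | yes (u , u∈i) = u , λ _ → u∈i
    ... | no none = w i , λ some → contradiction some none

    refined : ∀ x → (X ∩ Y) x → ∃ λ i → P x (proj₁ (representative i))
    refined x (x∈X , x∈Y) with i , x~wi ← cover x x∈X
                          with u∈Y , u~wi ← proj₂ (representative i) (x , x∈Y , x~wi) =
      i , Q∩Y⇒P x∈Y u∈Y (Q-trans x~wi (Q-sym u~wi))

module _ (G : Graph n) where

  NPart-isEquivalence : ∀ S → IsEquivalence (NPart G S)
  NPart-isEquivalence S = record { refl = inj₁ refl ; sym = N-sym ; trans = N-trans }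
    where
    N-sym : ∀ {u v} → NPart G S u v → NPart G S v u
    N-sym (inj₁ u≡v) = inj₁ (sym u≡v)
    N-sym (inj₂ (u∉S , v∉S , agree)) = inj₂ (v∉S , u∉S , λ t t∈S → sym (agree t t∈S))

    N-trans : ∀ {u v w} → NPart G S u v → NPart G S v w → NPart G S u w
    N-trans (inj₁ refl) vw = vw
    N-trans uv (inj₁ refl) = uv
    N-trans (inj₂ (u∉S , _ , uv)) (inj₂ (_ , w∉S , vw)) =
      inj₂ (u∉S , w∉S , λ t t∈S → trans (uv t t∈S) (vw t t∈S))

  NPart-dec : ∀ {S} → Decidable S → ∀ u v → Dec (NPart G S u v)
  NPart-dec S? u v = (u ≟ v) ⊎-dec (¬? (S? u) ×-dec ¬? (S? v) ×-dec
    all? (λ t → S? t →-dec (adj G u t Bool.≟ adj G v t)))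

  NPart-antitone : ∀ {S S′} → S ⊆ S′ → NPart G S′ ⪯ NPart G S
  NPart-antitone S⊆S′ u v (inj₁ u≡v) = inj₁ u≡v
  NPart-antitone S⊆S′ u v (inj₂ (u∉S′ , v∉S′ , agree)) =
    inj₂ (u∉S′ ∘′ S⊆S′ , v∉S′ ∘′ S⊆S′ , λ t t∈S → agree t (S⊆S′ t∈S))

  NPart-discrete : ∀ {S} → (∀ x → S x) → Discrete (NPart G S)
  NPart-discrete full u v (inj₁ u≡v) = u≡v
  NPart-discrete full u v (inj₂ (u∉S , _)) = contradiction (full u) u∉S

  NPart-trivial : ∀ {S} → (∀ x → ¬ S x) → Trivial (NPart G S)
  NPart-trivial empty u v = inj₂ (empty u , empty v , λ t t∈S → contradiction t∈S (empty t))

  NPart-addVertex : ∀ {S S′ s x y} → S ⊆ S′ ∪ ｛ s ｝ → s ≢ x → s ≢ y →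
                    adj G x s ≡ adj G y s → NPart G S′ x y → NPart G S x y
  NPart-addVertex S⊆S′+s s≢x s≢y xs≡ys (inj₁ x≡y) = inj₁ x≡y
  NPart-addVertex {S} {S′} {s} {x} {y} S⊆S′+s s≢x s≢y xs≡ys (inj₂ (x∉S′ , y∉S′ , agree)) =
    inj₂ (outside x∉S′ s≢x , outside y∉S′ s≢y , agree′)
    where
    outside : ∀ {z} → ¬ S′ z → s ≢ z → ¬ S z
    outside z∉S′ s≢z z∈S with S⊆S′+s z∈S
    ... | inj₁ z∈S′ = z∉S′ z∈S′
    ... | inj₂ s≡z = s≢z s≡z

    agree′ : ∀ t → S t → adj G x t ≡ adj G y t
    agree′ t t∈S with S⊆S′+s t∈S
    ... | inj₁ t∈S′ = agree t t∈S′
    ... | inj₂ refl = xs≡ys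

  partsAtMost-NPart-addVertex : ∀ {S S′ s} {X : Pred (Fin n) 0ℓ} → Decidable S′ →
                                S ⊆ S′ ∪ ｛ s ｝ →
                                PartsAtMost (NPart G S′) X k →
                                PartsAtMost (NPart G S) X (2 * k + 1)
  partsAtMost-NPart-addVertex {k} {S} {S′} {s} {X} S′? S⊆S′+s cover =
    subst (PartsAtMost N X) k+k+1≡2k+1
      (partsAtMost-⊆ {P = N} classify
        (partsAtMost-∪ {P = N} (partsAtMost-∪ {P = N} (side true) (side false))
                               (partsAtMost-｛｝ {P = N} (λ _ → inj₁ refl) s)))
    where
    N : VRel n
    N = NPart G S

    Side : Bool → Pred (Fin n) 0ℓ
    Side b x = s ≢ x × adj G x s ≡ b

    side : ∀ b → PartsAtMost N (X ∩ Side b) k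
    side b = partsAtMost-refine (NPart-dec S′?)
      (IsEquivalence.isPartialEquivalence (NPart-isEquivalence S′))
      (λ x → ¬? (s ≟ x) ×-dec (adj G x s Bool.≟ b))
      (λ (s≢x , xs≡b) (s≢y , ys≡b) → NPart-addVertex S⊆S′+s s≢x s≢y (trans xs≡b (sym ys≡b)))
      cover

    classify : X ⊆ ((X ∩ Side true) ∪ (X ∩ Side false)) ∪ ｛ s ｝
    classify {x} x∈X with s ≟ x
    ... | yes s≡x = inj₂ s≡x
    ... | no s≢x with adj G x s
    ...   | true  = inj₁ (inj₁ (x∈X , s≢x , refl))
    ...   | false = inj₁ (inj₂ (x∈X , s≢x , refl))

    k+k+1≡2k+1 : k + k + 1 ≡ 2 * k + 1
    k+k+1≡2k+1 = cong (λ m → k + m + 1) (sym (+-identityʳ k))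

module _ (σ : Fin n → Fin n) where

  Prefix-dec : ∀ t → Decidable (Prefix σ t)
  Prefix-dec t x = any? (λ j → (σ j ≟ x) ×-dec (toℕ j <? t))

  Prefix-mono : ∀ {t t′} → t ≤ t′ → Prefix σ t ⊆ Prefix σ t′
  Prefix-mono t≤t′ (j , σj≡x , j<t) = j , σj≡x , <-≤-trans j<t t≤t′

  Prefix-zero : ∀ {x} → ¬ Prefix σ 0 x
  Prefix-zero (_ , _ , ())

  Prefix-full : Injective _≡_ _≡_ σ → ∀ x → Prefix σ n x
  Prefix-full σ-inj x with j , σj≡x ← injective⇒surjective σ-inj x = j , σj≡x , toℕ<n j

  Prefix-suc : ∀ {j t} → toℕ j ≡ t → Prefix σ (suc t) ⊆ Prefix σ t ∪ ｛ σ j ｝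
  Prefix-suc {j} refl (i , σi≡x , s≤s i≤j) with toℕ i ℕ.≟ toℕ j
  ... | yes i≡j = inj₂ (trans (cong σ (sym (toℕ-injective i≡j))) σi≡x)
  ... | no i≢j = inj₁ (i , σi≡x , ≤∧≢⇒< i≤j i≢j)

lemma3p9 : ∀ {n : ℕ} (G : Graph n) (r k : ℕ) → DmwAtMost G r k → PmwAtMost G r (2 * k + 1)
lemma3p9 {n} G r k (σ , σ-inj , dmw) =
  n , Ps , (λ i → NPart-isEquivalence G _) ,
  NPart-discrete G (Prefix-full σ σ-inj) ,
  NPart-trivial G (λ x → Prefix-zero σ ∘′ Prefix-mono σ (≤-reflexive n∸[fromℕ-n]≡0)) ,
  (λ i → NPart-antitone G
           (Prefix-mono σ (≤-trans (n≤1+n _) (≤-reflexive (sym (n∸i≡1+[n∸1+i] i)))))) ,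
  -- the two prefixes differ by the vertex σ (opposite i), of index n ∸ suc i
  (λ i v → partsAtMost-NPart-addVertex G (Prefix-dec σ _)
             (Prefix-suc σ (opposite-prop i) ∘′ Prefix-mono σ (≤-reflexive (n∸i≡1+[n∸1+i] i)))
             (dmw (suc (toℕ i)) (s≤s z≤n) (toℕ<n i) v))
  where
  Ps : Fin (suc n) → VRel n
  Ps i = NPart G (Prefix σ (n ∸ toℕ i))

  n∸i≡1+[n∸1+i] : (i : Fin n) → n ∸ toℕ (inject₁ i) ≡ suc (n ∸ suc (toℕ i))
  n∸i≡1+[n∸1+i] i = trans (cong (n ∸_) (toℕ-inject₁ i)) (+-∸-assoc 1 (toℕ<n i))

  n∸[fromℕ-n]≡0 : n ∸ toℕ (fromℕ n) ≡ 0
  n∸[fromℕ-n]≡0 = trans (cong (n ∸_) (toℕ-fromℕ n)) (n∸n≡0 n)
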